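{- Let $S$ be a modal semiring and let $a\in S$ be d-transitive, i.e. $|a\rangle|a\rangle\le|a\rangle$. Then $a$ is Noetherian if and only if $a$ is Löbian, i.e. $|a\rangle\le|a\rangle\,\max_a$ (pointwise: $|a\rangle p\le |a\rangle(p-|a\rangle p)$ for all tests $p$).
   Context: An idempotent semiring is a structure $(S,+,\cdot,0,1)$ such that $(S,+,0)$ is a commutative monoid with $a+a=a$, $(S,\cdot,1)$ is a monoid, multiplication distributes over addition from both sides, and $0a=a0=0$; natural order $a\le b\iff a+b=b$. A test is an element $p\le 1$ for which some $q$ satisfies $p+q=1$ and $pq=0=qp$; $q$ is unique, written $\neg p$; tests form a Boolean algebra $\mathrm{test}(S)$ (join $+$, meet $\cdot$); $p-q=p\cdot\neg q$. $S$ is a modal semiring if for each $a\in S$ there are maps $|a\rangle,\langle a|$ on $\mathrm{test}(S)$ with, for all $a,b,p,q$: $|a\rangle p\le q\iff \neg q\,a\,p\le 0$; $\langle a|p\le q\iff p\,a\,\neg q\le 0$; $|ab\rangle p=|a\rangle(|b\rangle p)$; $\langle ab|p=\langle b|(\langle a|p)$. Maps on tests are ordered pointwise, juxtaposition is composition. $\max_a$ is the map $p\mapsto p-|a\rangle p$. $a$ is Noetherian if for all tests $p$, $\max_a p\le 0$ implies $p\le 0$. -}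

module Defs where

open import Level using (Level; _⊔_) renaming (suc to lsuc)
open import Algebra.Bundles using (IdempotentSemiring)
open import Data.Product using (_×_; _,_; proj₁; proj₂)
open import Function.Bundles using (_⇔_)
import Relation.Binary.Reasoning.Setoid as SetoidReasoning

module Tests {c ℓ : Level} (S : IdempotentSemiring c ℓ) where
  open IdempotentSemiring S

  infix 4 _≤_
  _≤_ : Carrier → Carrier → Set ℓ
  a ≤ b = a + b ≈ b

  record IsTest (p q : Carrier) : Set ℓ where
    field
      ≤1    : p ≤ 1#
      join  : p + q ≈ 1#
      meetˡ : p * q ≈ 0#
      meetʳ : q * p ≈ 0#

  -- an element of test(S), together with its (unique) complement ¬p
  record Test : Set (c ⊔ ℓ) where
    constructor mkTest
    field
      elem   : Carrier
      neg    : Carrier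
      isTest : IsTest elem neg

  open Test public

  private
    open SetoidReasoning setoid

    ≤-trans : ∀ {x y z} → x ≤ y → y ≤ z → x ≤ z
    ≤-trans {x} {y} {z} xy yz = begin
      x + z       ≈⟨ +-congˡ (sym yz) ⟩
      x + (y + z) ≈⟨ sym (+-assoc x y z) ⟩
      (x + y) + z ≈⟨ +-congʳ xy ⟩
      y + z       ≈⟨ yz ⟩
      z ∎

    ≤-antisym : ∀ {x y} → x ≤ y → y ≤ x → x ≈ y
    ≤-antisym {x} {y} xy yx = trans (sym yx) (trans (+-comm y x) xy)

    lub : ∀ {x y z} → x ≤ z → y ≤ z → x + y ≤ z
    lub {x} {y} {z} xz yz = begin
      (x + y) + z ≈⟨ +-assoc x y z ⟩
      x + (y + z) ≈⟨ +-congˡ yz ⟩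
      x + z       ≈⟨ xz ⟩
      z ∎

    ≤-resp : ∀ {x x' y} → x ≈ x' → x ≤ y → x' ≤ y
    ≤-resp e xy = trans (+-congʳ (sym e)) xy

    ≤-respʳ : ∀ {x y y'} → y ≈ y' → x ≤ y → x ≤ y'
    ≤-respʳ {x} e xy = trans (+-congˡ (sym e)) (trans xy e)

    *-monoˡ : ∀ {x y} z → x ≤ y → z * x ≤ z * y
    *-monoˡ {x} {y} z xy = trans (sym (distribˡ z x y)) (*-congˡ xy)

    *-monoʳ : ∀ {x y} z → x ≤ y → x * z ≤ y * z
    *-monoʳ {x} {y} z xy = trans (sym (distribʳ z x y)) (*-congʳ xy)

    ≤0 : ∀ {x} → x ≤ 0# → x ≈ 0#
    ≤0 {x} x0 = trans (sym (+-identityʳ x)) x0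

    le1ˡ : ∀ {x} y → x ≤ 1# → x * y ≤ y
    le1ˡ {x} y x1 = trans (+-congˡ (sym (*-identityˡ y)))
                     (trans (sym (distribʳ y x 1#)) (trans (*-congʳ x1) (*-identityˡ y)))

    le1ʳ : ∀ {x} y → x ≤ 1# → y * x ≤ y
    le1ʳ {x} y x1 = trans (+-congˡ (sym (*-identityʳ y)))
                     (trans (sym (distribˡ y x 1#)) (trans (*-congˡ x1) (*-identityʳ y)))

    le-+ : ∀ x y → x ≤ x + y
    le-+ x y = trans (sym (+-assoc x x y)) (+-congʳ (+-idem x))

    le-+r : ∀ x y → y ≤ x + y
    le-+r x y = trans (+-congˡ (+-comm x y)) (trans (le-+ y x) (+-comm y x))

    compl1 : ∀ {p q} → IsTest p q → q ≤ 1#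
    compl1 {p} {q} t = begin
      q + 1#       ≈⟨ +-congˡ (sym (IsTest.join t)) ⟩
      q + (p + q)  ≈⟨ +-congˡ (+-comm p q) ⟩
      q + (q + p)  ≈⟨ sym (+-assoc q q p) ⟩
      (q + q) + p  ≈⟨ +-congʳ (+-idem q) ⟩
      q + p        ≈⟨ +-comm q p ⟩
      p + q        ≈⟨ IsTest.join t ⟩
      1# ∎

  diff-isTest : (p q : Test) → IsTest (elem p * neg q) (neg p + elem q)
  diff-isTest (mkTest p p' tp) (mkTest r r' tr) = record
    { ≤1 = d≤1 ; join = j ; meetˡ = ml ; meetʳ = mr }
    where
    open IsTest
    d≤1 : p * r' ≤ 1#
    d≤1 = ≤-trans (le1ʳ p (≤1 (record { ≤1 = compl1 tr ; join = trans (+-comm r' r) (join tr)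
                                       ; meetˡ = meetʳ tr ; meetʳ = meetˡ tr }))) (≤1 tp)
    p≈ : p ≈ p * r' + p * r
    p≈ = begin
      p                 ≈⟨ sym (*-identityʳ p) ⟩
      p * 1#            ≈⟨ *-congˡ (sym (join tr)) ⟩
      p * (r + r')      ≈⟨ *-congˡ (+-comm r r') ⟩
      p * (r' + r)      ≈⟨ distribˡ p r' r ⟩
      p * r' + p * r ∎
    up : p * r' + (p' + r) ≤ 1#
    up = lub d≤1 (lub (compl1 tp) (≤1 tr))
    lo : 1# ≤ p * r' + (p' + r)
    T = p * r' + (p' + r)
    pT : p ≤ T
    pT = ≤-resp (sym p≈) (lub (le-+ (p * r') (p' + r))
           (≤-trans (le1ˡ r (≤1 tp)) (≤-trans (le-+r p' r) (le-+r (p * r') (p' + r)))))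
    lo = ≤-resp (join tp) (lub pT (≤-trans (le-+ p' r) (le-+r (p * r') (p' + r))))
    j : p * r' + (p' + r) ≈ 1#
    j = ≤-antisym up lo
    ml : p * r' * (p' + r) ≈ 0#
    ml = begin
      p * r' * (p' + r)               ≈⟨ distribˡ (p * r') p' r ⟩
      p * r' * p' + p * r' * r        ≈⟨ +-cong (*-assoc p r' p') (*-assoc p r' r) ⟩
      p * (r' * p') + p * (r' * r)    ≈⟨ +-cong (≤0 (≤-respʳ (meetˡ tp) (*-monoˡ p (le1ˡ p' (compl1 tr))))) (*-congˡ (meetʳ tr)) ⟩
      0# + p * 0#                     ≈⟨ +-identityˡ (p * 0#) ⟩
      p * 0#                          ≈⟨ zeroʳ p ⟩
      0# ∎
    mr : (p' + r) * (p * r') ≈ 0#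
    mr = begin
      (p' + r) * (p * r')             ≈⟨ distribʳ (p * r') p' r ⟩
      p' * (p * r') + r * (p * r')    ≈⟨ +-cong (sym (*-assoc p' p r')) (≤0 (≤-respʳ (meetˡ tr) (*-monoˡ r (le1ˡ r' (≤1 tp))))) ⟩
      p' * p * r' + 0#                ≈⟨ +-identityʳ (p' * p * r') ⟩
      p' * p * r'                     ≈⟨ *-congʳ (meetʳ tp) ⟩
      0# * r'                         ≈⟨ zeroˡ r' ⟩
      0# ∎

  _-ᵗ_ : Test → Test → Test
  p -ᵗ q = mkTest (elem p * neg q) (neg p + elem q) (diff-isTest p q)

record ModalSemiring (c ℓ : Level) : Set (lsuc (c ⊔ ℓ)) where
  field
    idemSemiring : IdempotentSemiring c ℓ
  open IdempotentSemiring idemSemiring public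
  open Tests idemSemiring public
  field
    fdia : Carrier → Test → Test
    bdia : Carrier → Test → Test
    fdia-galois : ∀ a (p q : Test) → (elem (fdia a p) ≤ elem q ⇔ neg q * a * elem p ≤ 0#)
    bdia-galois : ∀ a (p q : Test) → (elem (bdia a p) ≤ elem q ⇔ elem p * a * neg q ≤ 0#)
    fdia-comp : ∀ a b (p : Test) → elem (fdia (a * b) p) ≈ elem (fdia a (fdia b p))
    bdia-comp : ∀ a b (p : Test) → elem (bdia (a * b) p) ≈ elem (bdia b (bdia a p))

module _ {c ℓ : Level} (M : ModalSemiring c ℓ) where
  open ModalSemiring M

  _≤ₘ_ : (Test → Test) → (Test → Test) → Set (c ⊔ ℓ)
  f ≤ₘ g = ∀ p → elem (f p) ≤ elem (g p)

  max : Carrier → Test → Test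
  max a p = p -ᵗ fdia a p

  DTransitive : Carrier → Set (c ⊔ ℓ)
  DTransitive a = (λ p → fdia a (fdia a p)) ≤ₘ fdia a

  Noetherian : Carrier → Set (c ⊔ ℓ)
  Noetherian a = ∀ p → elem (max a p) ≤ 0# → elem p ≤ 0#

  Loebian : Carrier → Set (c ⊔ ℓ)
  Loebian a = fdia a ≤ₘ (λ p → fdia a (max a p))

module Submission where

-- Two facts about the forward diamond |a⟩ are all that is
-- needed: it is strict (|a⟩0 = 0), and it is subadditive
-- (|a⟩(p + q) ≤ |a⟩p + |a⟩q); both follow from the Galois connection
-- |a⟩p ≤ q ⇔ ¬q·a·p ≤ 0.  Together with elementary test algebra
-- (p ≤ (p - q) + q, and p - q ≤ 0 ⇔ p ≤ q) the two directions are: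
--   * Löbian ⇒ Noetherian: if max_a p = p - |a⟩p ≤ 0 then p ≤ |a⟩p
--     ≤ |a⟩(max_a p) ≤ |a⟩0 = 0.  No transitivity is used.
--   * Noetherian ⇒ Löbian (for d-transitive a): the "Löb defect"
--     r = |a⟩p - |a⟩(max_a p) satisfies r ≤ |a⟩r, i.e. max_a r ≤ 0, so
--     r ≤ 0 by Noetherianity, which says |a⟩p ≤ |a⟩(max_a p).

open import Defs
open import Level using (Level)
open import Algebra.Bundles using (IdempotentSemiring)
open import Function.Bundles using (_⇔_; mk⇔; Equivalence)
open import Relation.Binary.Bundles using (Poset)
import Relation.Binary.Reasoning.PartialOrder as PosetReasoning

module NaturalOrder {c ℓ : Level} (S : IdempotentSemiring c ℓ) where
  open IdempotentSemiring S
  open Tests S using (_≤_)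

  ≤-reflexive : ∀ {x y} → x ≈ y → x ≤ y
  ≤-reflexive {x} {y} x≈y = trans (+-congʳ x≈y) (+-idem y)

  ≤-refl : ∀ {x} → x ≤ x
  ≤-refl = ≤-reflexive refl

  ≤-trans : ∀ {x y z} → x ≤ y → y ≤ z → x ≤ z
  ≤-trans {x} {y} {z} x≤y y≤z =
    trans (+-congˡ (sym y≤z)) (trans (sym (+-assoc x y z)) (trans (+-congʳ x≤y) y≤z))

  ≤-antisym : ∀ {x y} → x ≤ y → y ≤ x → x ≈ y
  ≤-antisym {x} {y} x≤y y≤x = trans (sym y≤x) (trans (+-comm y x) x≤y)

  ≤-poset : Poset c ℓ ℓ
  ≤-poset = record
    { _≈_ = _≈_ ; _≤_ = _≤_
    ; isPartialOrder = record
      { isPreorder = record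
        { isEquivalence = isEquivalence ; reflexive = ≤-reflexive ; trans = ≤-trans }
      ; antisym = ≤-antisym
      }
    }

  +-least : ∀ {x y z} → x ≤ z → y ≤ z → x + y ≤ z
  +-least {x} {y} {z} x≤z y≤z = trans (+-assoc x y z) (trans (+-congˡ y≤z) x≤z)

  x≤x+y : ∀ x y → x ≤ x + y
  x≤x+y x y = trans (sym (+-assoc x x y)) (+-congʳ (+-idem x))

  y≤x+y : ∀ x y → y ≤ x + y
  y≤x+y x y = ≤-trans (x≤x+y y x) (≤-reflexive (+-comm y x))

  +-mono : ∀ {x x′ y y′} → x ≤ x′ → y ≤ y′ → x + y ≤ x′ + y′
  +-mono {x′ = x′} {y′ = y′} x≤x′ y≤y′ =
    +-least (≤-trans x≤x′ (x≤x+y x′ y′)) (≤-trans y≤y′ (y≤x+y x′ y′))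

  +-monoʳ : ∀ {x y} z → x ≤ y → z + x ≤ z + y
  +-monoʳ z x≤y = +-mono ≤-refl x≤y

  *-monoˡ : ∀ {x y} z → x ≤ y → z * x ≤ z * y
  *-monoˡ {x} {y} z x≤y = trans (sym (distribˡ z x y)) (*-congˡ x≤y)

  *-monoʳ : ∀ {x y} z → x ≤ y → x * z ≤ y * z
  *-monoʳ {x} {y} z x≤y = trans (sym (distribʳ z x y)) (*-congʳ x≤y)

  ≤1⇒*-decreasingˡ : ∀ {x} y → x ≤ 1# → x * y ≤ y
  ≤1⇒*-decreasingˡ y x≤1 = ≤-trans (*-monoʳ y x≤1) (≤-reflexive (*-identityˡ y))

  ≤1⇒*-decreasingʳ : ∀ {x} y → x ≤ 1# → y * x ≤ y
  ≤1⇒*-decreasingʳ y x≤1 = ≤-trans (*-monoˡ y x≤1) (≤-reflexive (*-identityʳ y))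

module TestAlgebra {c ℓ : Level} (S : IdempotentSemiring c ℓ) where
  open IdempotentSemiring S
  open Tests S
  open NaturalOrder S
  open PosetReasoning ≤-poset

  IsTest-swap : ∀ {p q} → IsTest p q → IsTest q p
  IsTest-swap {p} {q} t = record
    { ≤1    = ≤-trans (y≤x+y p q) (≤-reflexive join)
    ; join  = trans (+-comm q p) join
    ; meetˡ = meetʳ
    ; meetʳ = meetˡ
    }
    where open IsTest t

  neg≤1 : (p : Test) → neg p ≤ 1#
  neg≤1 p = IsTest.≤1 (IsTest-swap (isTest p))

  ¬ᵗ_ : Test → Test
  ¬ᵗ p = mkTest (neg p) (elem p) (IsTest-swap (isTest p))

  -- join of tests by De Morgan; its element is definitionally p + q
  _∨ᵗ_ : Test → Test → Test
  p ∨ᵗ q = ¬ᵗ ((¬ᵗ p) -ᵗ q)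

  0ᵗ : Test
  0ᵗ = mkTest 0# 1# record
    { ≤1 = +-identityˡ 1# ; join = +-identityˡ 1# ; meetˡ = zeroˡ 1# ; meetʳ = zeroʳ 1# }

  split : (p q : Test) → elem p ≤ elem (p -ᵗ q) + elem q
  split p q = begin
    elem p                                ≈⟨ sym (*-identityʳ (elem p)) ⟩
    elem p * 1#                           ≈⟨ *-congˡ (sym (trans (+-comm (neg q) (elem q)) (IsTest.join (isTest q)))) ⟩
    elem p * (neg q + elem q)             ≈⟨ distribˡ (elem p) (neg q) (elem q) ⟩
    elem p * neg q + elem p * elem q      ≤⟨ +-monoʳ (elem p * neg q) (≤1⇒*-decreasingˡ (elem q) (IsTest.≤1 (isTest p))) ⟩
    elem p * neg q + elem q               ∎

  shunt : ∀ {x y} (q : Test) → x ≤ elem q + y → x * neg q ≤ y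
  shunt {x} {y} q x≤q+y = begin
    x * neg q                             ≤⟨ *-monoʳ (neg q) x≤q+y ⟩
    (elem q + y) * neg q                  ≈⟨ distribʳ (neg q) (elem q) y ⟩
    elem q * neg q + y * neg q            ≈⟨ +-congʳ (IsTest.meetˡ (isTest q)) ⟩
    0# + y * neg q                        ≈⟨ +-identityˡ (y * neg q) ⟩
    y * neg q                             ≤⟨ ≤1⇒*-decreasingʳ y (neg≤1 q) ⟩
    y                                     ∎

  ≤⇒diff≤0 : ∀ {x} (q : Test) → x ≤ elem q → x * neg q ≤ 0#
  ≤⇒diff≤0 {x} q x≤q = shunt q (≤-trans x≤q (x≤x+y (elem q) 0#))

  diff≤0⇒≤ : (p q : Test) → elem (p -ᵗ q) ≤ 0# → elem p ≤ elem q
  diff≤0⇒≤ p q p-q≤0 = begin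
    elem p                                ≤⟨ split p q ⟩
    elem (p -ᵗ q) + elem q                ≤⟨ +-mono p-q≤0 ≤-refl ⟩
    0# + elem q                           ≈⟨ +-identityˡ (elem q) ⟩
    elem q                                ∎

module Diamond {c ℓ : Level} (M : ModalSemiring c ℓ) where
  open ModalSemiring M
  open NaturalOrder idemSemiring
  open TestAlgebra idemSemiring
  open Equivalence

  fdia-counit : ∀ a (p : Test) → neg (fdia a p) * a * elem p ≤ 0#
  fdia-counit a p = to (fdia-galois a p (fdia a p)) ≤-refl

  fdia-strict : ∀ a (p : Test) → elem p ≤ 0# → elem (fdia a p) ≤ 0#
  fdia-strict a p p≤0 = from (fdia-galois a p 0ᵗ)
    (≤-trans (*-monoˡ (1# * a) p≤0) (≤-reflexive (zeroʳ (1# * a))))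

  -- |a⟩ is subadditive: the complement ¬|a⟩p·¬|a⟩q of the join kills a·p and a·q
  fdia-subadditive : ∀ a {s : Test} (p q : Test) → elem s ≤ elem p + elem q →
                     elem (fdia a s) ≤ elem (fdia a p) + elem (fdia a q)
  fdia-subadditive a {s} p q s≤p+q = from (fdia-galois a s (P ∨ᵗ Q))
      (≤-trans (*-monoˡ (¬P¬Q * a) s≤p+q)
        (≤-trans (≤-reflexive (distribˡ (¬P¬Q * a) (elem p) (elem q)))
          (+-least kills-p kills-q)))
    where
    open PosetReasoning ≤-poset
    P = fdia a p
    Q = fdia a q
    ¬P¬Q = neg P * neg Q
    kills-p : ¬P¬Q * a * elem p ≤ 0#
    kills-p = begin
      ¬P¬Q * a * elem p                   ≈⟨ *-congʳ (*-assoc (neg P) (neg Q) a) ⟩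
      neg P * (neg Q * a) * elem p        ≤⟨ *-monoʳ (elem p) (*-monoˡ (neg P) (≤1⇒*-decreasingˡ a (neg≤1 Q))) ⟩
      neg P * a * elem p                  ≤⟨ fdia-counit a p ⟩
      0#                                  ∎
    kills-q : ¬P¬Q * a * elem q ≤ 0#
    kills-q = begin
      ¬P¬Q * a * elem q                   ≈⟨ trans (*-congʳ (*-assoc (neg P) (neg Q) a)) (*-assoc (neg P) (neg Q * a) (elem q)) ⟩
      neg P * (neg Q * a * elem q)        ≤⟨ ≤1⇒*-decreasingˡ (neg Q * a * elem q) (neg≤1 P) ⟩
      neg Q * a * elem q                  ≤⟨ fdia-counit a q ⟩
      0#                                  ∎

module NoetherLoeb {c ℓ : Level} (M : ModalSemiring c ℓ) where
  open ModalSemiring M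
  open NaturalOrder idemSemiring
  open TestAlgebra idemSemiring
  open Diamond M
  open PosetReasoning ≤-poset

  loebian⇒noetherian : ∀ a → Loebian M a → Noetherian M a
  loebian⇒noetherian a loeb p max≤0 = begin
    elem p                                ≤⟨ diff≤0⇒≤ p (fdia a p) max≤0 ⟩
    elem (fdia a p)                       ≤⟨ loeb p ⟩
    elem (fdia a (max M a p))             ≤⟨ fdia-strict a (max M a p) max≤0 ⟩
    0#                                    ∎

  -- the Löb defect of p: the part of |a⟩p not reached through max_a p
  loebDefect : Carrier → Test → Test
  loebDefect a p = fdia a p -ᵗ fdia a (max M a p)

  -- for d-transitive a the defect is a-reachable from itself, so it has no maximal part
  loebDefect-recurrent : ∀ a → DTransitive M a → ∀ p →
                         elem (loebDefect a p) ≤ elem (fdia a (loebDefect a p))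
  loebDefect-recurrent a trans-a p = shunt Mm F≤Mm+R
    where
    F  = fdia a p
    m  = max M a p
    Mm = fdia a m
    R  = fdia a (loebDefect a p)
    F≤Mm+R : elem F ≤ elem Mm + elem R
    F≤Mm+R = begin
      elem F                              ≤⟨ fdia-subadditive a m F (split p F) ⟩
      elem Mm + elem (fdia a F)           ≤⟨ +-monoʳ (elem Mm) (fdia-subadditive a (loebDefect a p) Mm (split F Mm)) ⟩
      elem Mm + (elem R + elem (fdia a Mm)) ≤⟨ +-monoʳ (elem Mm) (+-monoʳ (elem R) (trans-a m)) ⟩
      elem Mm + (elem R + elem Mm)        ≈⟨ +-congˡ (+-comm (elem R) (elem Mm)) ⟩
      elem Mm + (elem Mm + elem R)        ≈⟨ sym (+-assoc (elem Mm) (elem Mm) (elem R)) ⟩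
      (elem Mm + elem Mm) + elem R        ≈⟨ +-congʳ (+-idem (elem Mm)) ⟩
      elem Mm + elem R                    ∎

  -- every d-transitive Noetherian element is Löbian: the defect vanishes
  noetherian⇒loebian : ∀ a → DTransitive M a → Noetherian M a → Loebian M a
  noetherian⇒loebian a trans-a noeth p =
    diff≤0⇒≤ (fdia a p) (fdia a (max M a p))
      (noeth (loebDefect a p)
        (≤⇒diff≤0 (fdia a (loebDefect a p)) (loebDefect-recurrent a trans-a p)))

corollary5p6 : {c ℓ : Level} (M : ModalSemiring c ℓ) (a : ModalSemiring.Carrier M) →
    DTransitive M a → (Noetherian M a ⇔ Loebian M a)
corollary5p6 M a trans-a =
  mk⇔ (noetherian⇒loebian a trans-a) (loebian⇒noetherian a)
  where open NoetherLoeb M
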